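{- Let $s$ be the Sierpi\`nski word, i.e., the fixed point starting with $a$ of the substitution $\sigma$ on $\{a,b\}$ given by $\sigma(a)=aba$, $\sigma(b)=bbb$ (equivalently, $s=\lim_{n\to\infty}s_n$ where $s_0=a$ and $s_{n+1}=s_n b^{3^n} s_n$). Then $s$ contains no $11$-antipower as a factor; hence $s$ contains no abelian $11$-antipower as a factor.
   Context: A $k$-antipower is a word of the form $u_1u_2\cdots u_k$ where the $u_i$ are words of the same length that are pairwise distinct. The Parikh vector of a word $w$ over an ordered finite alphabet $\{a_1,\dots,a_t\}$ is the vector whose $i$-th component is the number of occurrences of $a_i$ in $w$. An abelian $k$-antipower is a word $u_1\cdots u_k$ where the $u_i$ have the same length and pairwise distinct Parikh vectors. A factor of an infinite word is a finite block of consecutive letters of it. -}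

module Defs where

open import Data.Nat using (ℕ; zero; suc; _+_; _*_; _^_; _<_)
open import Data.List using (List; []; _∷_; _++_; map; upTo; replicate; lookup; length; filter; [_])
open import Data.Fin using (Fin; fromℕ<)
open import Data.Maybe using (Maybe; just; nothing)
open import Data.Product using (Σ; _×_; _,_; ∃-syntax)
open import Relation.Binary.PropositionalEquality using (_≡_)
open import Relation.Nullary using (¬_)

data Letter : Set where
  a b : Letter

σ : Letter → List Letter
σ a = a ∷ b ∷ a ∷ []
σ b = b ∷ b ∷ b ∷ []

σ* : List Letter → List Letter
σ* [] = []
σ* (x ∷ w) = σ x ++ σ* w

sPrefix : ℕ → List Letter
sPrefix zero = a ∷ []
sPrefix (suc n) = σ* (sPrefix n)

_!?_ : {A : Set} → List A → ℕ → Maybe A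
[] !? _ = nothing
(x ∷ _) !? zero = just x
(_ ∷ xs) !? suc n = xs !? n

-- the Sierpinski word s = lim σ^n(a): its letter at position i (0-based) is
-- the i-th letter of σ^(i+1)(a), which has length 3^(i+1) > i.
-- (the nothing-case never occurs)
sier : ℕ → Letter
sier i with sPrefix (suc i) !? i
... | just x = x
... | nothing = a

factor : (ℕ → Letter) → ℕ → ℕ → List Letter
factor x i m = map (λ t → x (i + t)) (upTo m)

-- the factor u_1 ... u_k starting at i with |u_j| = m, i.e. u_{j+1} = factor x (i + j*m) m
block : (ℕ → Letter) → ℕ → ℕ → ℕ → List Letter
block x i m j = factor x (i + j * m) m

count : Letter → List Letter → ℕ
count _ [] = 0
count a (a ∷ w) = suc (count a w)
count a (b ∷ w) = count a w
count b (a ∷ w) = count b w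
count b (b ∷ w) = suc (count b w)

parikh : List Letter → ℕ × ℕ
parikh w = count a w , count b w

HasAntipowerFactor : ℕ → (ℕ → Letter) → Set
HasAntipowerFactor k x =
  ∃[ i ] ∃[ m ] (∀ j j' → j < k → j' < k → ¬ (j ≡ j') → ¬ (block x i m j ≡ block x i m j'))

HasAbelianAntipowerFactor : ℕ → (ℕ → Letter) → Set
HasAbelianAntipowerFactor k x =
  ∃[ i ] ∃[ m ] (∀ j j' → j < k → j' < k → ¬ (j ≡ j') →
    ¬ (parikh (block x i m j) ≡ parikh (block x i m j')))

-- The letter a occurs in s exactly at the positions whose ternary expansion avoids
-- the digit 1.  Two consequences drive the proof: if k * 3^n + r (with r < 3^n) carries
-- an a then so do k and r, and no two a's are adjacent.  Given a block length M, pick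
-- u = 3^t with u ≤ M + 1 < 3u and put U = 9u ≥ 3M.  If the window of 11 blocks meets
-- a's in two different U-blocks, these are not adjacent, so the whole U-block between
-- them consists of b's; having length U ≥ 3M, it contains two full blocks.
-- Otherwise all a's of the window lie in a single U-block, and inside it only in the
-- sub-blocks of length u with indices 0, 2, 6, 8; each of these meets at most two
-- blocks, so at least three of the 11 blocks are b^M.  Either way two blocks coincide.

module Submission where

open import Defs
open import Data.Nat using (ℕ; zero; suc; _+_; _*_; _^_; _≤_; _<_; _∸_; z≤n; s≤s; s≤s⁻¹; z<s; s<s; NonZero)
open import Data.Nat.Properties
open import Data.Nat.DivMod using (_/_; _%_; m≡m%n+[m/n]*n; m%n<n; m/n*n≤m; m<n*o⇒m/o<n)
open import Data.Nat.Tactic.RingSolver using (solve-∀)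
open import Data.Fin using (Fin; toℕ)
open import Data.Fin.Properties using (pigeonhole; toℕ<n)
open import Data.List using (List; []; _∷_; _++_; length; map; upTo; lookup)
open import Data.List.Properties using (++-assoc; length-++; map-cong-local)
open import Data.List.Relation.Unary.All.Properties using (applyUpTo⁺₁)
open import Data.List.Relation.Unary.Any using (here; there; index)
open import Data.List.Relation.Unary.Any.Properties using (lookup-index)
open import Data.List.Membership.Propositional using (_∈_; _∉_)
open import Data.List.Membership.Propositional.Properties using (∈-map⁺)
open import Data.List.Membership.DecPropositional _≟_ using (_∈?_)
open import Data.Maybe using (just)
open import Data.Maybe.Properties using (just-injective)
open import Data.Product using (_×_; _,_; ∃-syntax; proj₁; proj₂; map₂)
open import Data.Sum using (_⊎_; inj₁; inj₂)
open import Data.Empty using (⊥-elim)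
open import Data.Nat.Induction using (<-wellFounded)
open import Induction.WellFounded using (Acc; acc)
open import Relation.Binary using (DecidableEquality; tri<; tri≈; tri>)
open import Relation.Binary.PropositionalEquality
open import Relation.Nullary using (Dec; yes; no; ¬_; ¬?)
open import Relation.Nullary.Decidable using (decidable-stable; _×-dec_)

_≟ₗ_ : DecidableEquality Letter
a ≟ₗ a = yes refl
a ≟ₗ b = no λ ()
b ≟ₗ a = no λ ()
b ≟ₗ b = yes refl

≢a⇒≡b : ∀ {x} → x ≢ a → x ≡ b
≢a⇒≡b {a} x≢a = ⊥-elim (x≢a refl)
≢a⇒≡b {b} _ = refl

b≢a : b ≢ a
b≢a ()

n<3^[1+n] : ∀ n → n < 3 ^ suc n
n<3^[1+n] zero = s≤s z≤n
n<3^[1+n] (suc n) = ≤-<-trans (n<3^[1+n] n) (^-monoʳ-< 3 (s≤s (s≤s z≤n)) (n<1+n (suc n)))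

m<[1+m/n]*n : ∀ m n .{{_ : NonZero n}} → m < suc (m / n) * n
m<[1+m/n]*n m n = begin-strict
  m                 ≡⟨ m≡m%n+[m/n]*n m n ⟩
  m % n + m / n * n <⟨ +-monoˡ-< (m / n * n) (m%n<n m n) ⟩
  n + m / n * n     ∎
  where open ≤-Reasoning

m≡[m/n]*n+m%n : ∀ m n .{{_ : NonZero n}} → m ≡ m / n * n + m % n
m≡[m/n]*n+m%n m n = trans (m≡m%n+[m/n]*n m n) (+-comm (m % n) _)

j*M+t<k*M : ∀ {j k M t} → j < k → t < M → j * M + t < k * M
j*M+t<k*M {j} {k} {M} j<k t<M =
  <-≤-trans (+-monoʳ-< (j * M) t<M) (subst (_≤ k * M) (+-comm M (j * M)) (*-monoˡ-≤ M j<k))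

power-bracket : ∀ β → 1 < β → ∀ n → ∃[ t ] β ^ t ≤ suc n × suc n < β ^ suc t
power-bracket β 1<β zero = 0 , ≤-refl , subst (1 <_) (sym (*-identityʳ β)) 1<β
power-bracket β 1<β (suc n) with power-bracket β 1<β n
... | t , lower , upper with suc (suc n) <? β ^ suc t
...   | yes upper′ = t , m≤n⇒m≤1+n lower , upper′
...   | no ¬upper′ = suc t , ≤-reflexive (sym 2+n≡β^[1+t]) ,
                     subst (_< β ^ suc (suc t)) (sym 2+n≡β^[1+t]) (^-monoʳ-< β 1<β (n<1+n (suc t)))
  where
  2+n≡β^[1+t] : suc (suc n) ≡ β ^ suc t
  2+n≡β^[1+t] = ≤-antisym upper (≮⇒≥ ¬upper′)

all-below∈⇒≤length : ∀ (F : List ℕ) {n} → (∀ (j : Fin n) → toℕ j ∈ F) → n ≤ length F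
all-below∈⇒≤length F {n} member with n ≤? length F
... | yes n≤|F| = n≤|F|
... | no n≰|F| with pigeonhole (≰⇒> n≰|F|) (λ j → index (member j))
...   | i , j , i<j , same = ⊥-elim (<⇒≢ i<j (begin
  toℕ i                      ≡⟨ lookup-index (member i) ⟩
  lookup F (index (member i)) ≡⟨ cong (lookup F) same ⟩
  lookup F (index (member j)) ≡⟨ lookup-index (member j) ⟨
  toℕ j                      ∎))
  where open ≡-Reasoning

∃-∉-below : ∀ (F : List ℕ) {n} → length F < n → ∃[ j ] j < n × j ∉ F
∃-∉-below F {n} |F|<n with anyUpTo? (λ j → ¬? (j ∈? F)) n
... | yes found = found
... | no none = ⊥-elim (<⇒≱ |F|<n (all-below∈⇒≤length F member))
  where
  member : (j : Fin n) → toℕ j ∈ F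
  member j = decidable-stable (toℕ j ∈? F) (λ j∉F → none (toℕ j , toℕ<n j , j∉F))

σ*-++ : ∀ u v → σ* (u ++ v) ≡ σ* u ++ σ* v
σ*-++ [] v = refl
σ*-++ (x ∷ u) v = trans (cong (σ x ++_) (σ*-++ u v)) (sym (++-assoc (σ x) (σ* u) (σ* v)))

length-σ : ∀ x → length (σ x) ≡ 3
length-σ a = refl
length-σ b = refl

length-σ* : ∀ w → length (σ* w) ≡ 3 * length w
length-σ* [] = refl
length-σ* (x ∷ w) = begin
  length (σ x ++ σ* w)          ≡⟨ length-++ (σ x) ⟩
  length (σ x) + length (σ* w)  ≡⟨ cong₂ _+_ (length-σ x) (length-σ* w) ⟩
  3 + 3 * length w              ≡⟨ *-suc 3 (length w) ⟨
  3 * suc (length w)            ∎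
  where open ≡-Reasoning

length-sPrefix : ∀ n → length (sPrefix n) ≡ 3 ^ n
length-sPrefix zero = refl
length-sPrefix (suc n) = trans (length-σ* (sPrefix n)) (cong (3 *_) (length-sPrefix n))

sPrefix-extends : ∀ n → ∃[ w ] sPrefix (suc n) ≡ sPrefix n ++ w
sPrefix-extends zero = b ∷ a ∷ [] , refl
sPrefix-extends (suc n) with sPrefix-extends n
... | w , eq = σ* w , trans (cong σ* eq) (σ*-++ (sPrefix n) w)

!?-++ˡ : ∀ {A : Set} (u v : List A) {i} → i < length u → (u ++ v) !? i ≡ u !? i
!?-++ˡ (x ∷ u) v {zero} _ = refl
!?-++ˡ (x ∷ u) v {suc i} (s<s i<) = !?-++ˡ u v i<

!?-++ʳ : ∀ {A : Set} (u v : List A) i → (u ++ v) !? (length u + i) ≡ v !? i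
!?-++ʳ [] v i = refl
!?-++ʳ (x ∷ u) v i = !?-++ʳ u v i

!?-defined : ∀ {A : Set} (u : List A) {i} → i < length u → ∃[ x ] u !? i ≡ just x
!?-defined (x ∷ u) {zero} _ = x , refl
!?-defined (x ∷ u) {suc i} (s<s i<) = !?-defined u i<

sPrefix-!?-stable : ∀ k n {i} → i < 3 ^ n → sPrefix (k + n) !? i ≡ sPrefix n !? i
sPrefix-!?-stable zero n i< = refl
sPrefix-!?-stable (suc k) n {i} i< with sPrefix-extends (k + n)
... | w , eq = begin
  sPrefix (suc k + n) !? i        ≡⟨ cong (_!? i) eq ⟩
  (sPrefix (k + n) ++ w) !? i     ≡⟨ !?-++ˡ (sPrefix (k + n)) w i<|prefix| ⟩
  sPrefix (k + n) !? i            ≡⟨ sPrefix-!?-stable k n i< ⟩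
  sPrefix n !? i                  ∎
  where
  open ≡-Reasoning
  i<|prefix| : i < length (sPrefix (k + n))
  i<|prefix| = subst (i <_) (sym (length-sPrefix (k + n))) (<-≤-trans i< (^-monoʳ-≤ 3 (m≤n+m n k)))

sier-from-!? : ∀ {i x} → sPrefix (suc i) !? i ≡ just x → sier i ≡ x
sier-from-!? {i} eq with sPrefix (suc i) !? i
sier-from-!? refl | just x = refl

sPrefix-!? : ∀ n {i} → i < 3 ^ n → sPrefix n !? i ≡ just (sier i)
sPrefix-!? n {i} i< with !?-defined (sPrefix (suc i)) (subst (i <_) (sym (length-sPrefix (suc i))) (n<3^[1+n] i))
... | x , eq = begin
  sPrefix n !? i                ≡⟨ sPrefix-!?-stable (suc i) n i< ⟨
  sPrefix (suc i + n) !? i      ≡⟨ cong (λ m → sPrefix m !? i) (+-comm (suc i) n) ⟩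
  sPrefix (n + suc i) !? i      ≡⟨ sPrefix-!?-stable n (suc i) (n<3^[1+n] i) ⟩
  sPrefix (suc i) !? i          ≡⟨ eq ⟩
  just x                        ≡⟨ cong just (sier-from-!? {i} eq) ⟨
  just (sier i)                 ∎
  where open ≡-Reasoning

σ*-!? : ∀ w {q x} d → d < 3 → w !? q ≡ just x → σ* w !? (d + q * 3) ≡ σ x !? d
σ*-!? (y ∷ w) {zero} d d<3 refl =
  trans (cong ((σ y ++ σ* w) !?_) (+-identityʳ d))
        (!?-++ˡ (σ y) (σ* w) (subst (d <_) (sym (length-σ y)) d<3))
σ*-!? (y ∷ w) {suc q} {x} d d<3 eq = begin
  (σ y ++ σ* w) !? (d + (3 + q * 3))              ≡⟨ cong ((σ y ++ σ* w) !?_) shift ⟩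
  (σ y ++ σ* w) !? (length (σ y) + (d + q * 3))   ≡⟨ !?-++ʳ (σ y) (σ* w) (d + q * 3) ⟩
  σ* w !? (d + q * 3)                             ≡⟨ σ*-!? w d d<3 eq ⟩
  σ x !? d                                        ∎
  where
  open ≡-Reasoning
  swap : ∀ m n o → m + (n + o) ≡ n + (m + o)
  swap = solve-∀
  shift : d + (3 + q * 3) ≡ length (σ y) + (d + q * 3)
  shift = trans (swap d 3 (q * 3)) (cong (_+ (d + q * 3)) (sym (length-σ y)))

d+q*3<3^[2+q] : ∀ q {d} → d < 3 → d + q * 3 < 3 ^ suc (suc q)
d+q*3<3^[2+q] q {d} d<3 = begin-strict
  d + q * 3           <⟨ +-monoˡ-< (q * 3) d<3 ⟩
  suc q * 3           ≤⟨ *-monoˡ-≤ 3 (n<3^[1+n] q) ⟩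
  3 ^ suc q * 3       ≡⟨ *-comm (3 ^ suc q) 3 ⟩
  3 ^ suc (suc q)     ∎
  where open ≤-Reasoning

sier-σ : ∀ q d → d < 3 → just (sier (d + q * 3)) ≡ σ (sier q) !? d
sier-σ q d d<3 = begin
  just (sier (d + q * 3))                   ≡⟨ sPrefix-!? (suc (suc q)) (d+q*3<3^[2+q] q d<3) ⟨
  σ* (sPrefix (suc q)) !? (d + q * 3)       ≡⟨ σ*-!? (sPrefix (suc q)) d d<3 (sPrefix-!? (suc q) (n<3^[1+n] q)) ⟩
  σ (sier q) !? d                           ∎
  where open ≡-Reasoning

sier[q*3]≡sier[q] : ∀ q → sier (q * 3) ≡ sier q
sier[q*3]≡sier[q] q with sier q | sier-σ q 0 (s≤s z≤n)
... | a | eq = just-injective eq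
... | b | eq = just-injective eq

sier[1+q*3]≡b : ∀ q → sier (1 + q * 3) ≡ b
sier[1+q*3]≡b q with sier q | sier-σ q 1 (s≤s (s≤s z≤n))
... | a | eq = just-injective eq
... | b | eq = just-injective eq

sier[2+q*3]≡sier[q] : ∀ q → sier (2 + q * 3) ≡ sier q
sier[2+q*3]≡sier[q] q with sier q | sier-σ q 2 (s≤s (s≤s (s≤s z≤n)))
... | a | eq = just-injective eq
... | b | eq = just-injective eq

data LastTrit : ℕ → Set where
  ends0 : ∀ q → LastTrit (q * 3)
  ends1 : ∀ q → LastTrit (1 + q * 3)
  ends2 : ∀ q → LastTrit (2 + q * 3)

lastTrit : ∀ n → LastTrit n
lastTrit zero = ends0 0
lastTrit (suc n) with lastTrit n
... | ends0 q = ends1 q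
... | ends1 q = ends2 q
... | ends2 q = ends0 (suc q)

sier-a-split : ∀ n k {r} → r < 3 ^ n → sier (k * 3 ^ n + r) ≡ a → sier k ≡ a × sier r ≡ a
sier-a-split zero k {zero} _ eq = subst (λ m → sier m ≡ a) (trans (+-identityʳ _) (*-identityʳ k)) eq , refl
sier-a-split zero k {suc r} (s≤s ()) _
sier-a-split (suc n) k {r} = go (lastTrit r)
  where
  regroup : ∀ k p d q → k * (3 * p) + (d + q * 3) ≡ d + (k * p + q) * 3
  regroup = solve-∀
  peel : ∀ d {q} → (∀ m → sier (d + m * 3) ≡ sier m) → d + q * 3 < 3 ^ suc n →
         sier (k * 3 ^ suc n + (d + q * 3)) ≡ a → sier k ≡ a × sier (d + q * 3) ≡ a
  peel d {q} law r< eq = map₂ (trans (law q)) (sier-a-split n k q<3^n shifted-a)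
    where
    q<3^n : q < 3 ^ n
    q<3^n = *-cancelʳ-< 3 q (3 ^ n) (≤-<-trans (m≤n+m (q * 3) d) (subst (d + q * 3 <_) (*-comm 3 (3 ^ n)) r<))
    shifted-a : sier (k * 3 ^ n + q) ≡ a
    shifted-a = trans (sym (law (k * 3 ^ n + q))) (subst (λ m → sier m ≡ a) (regroup k (3 ^ n) d q) eq)
  go : ∀ {r} → LastTrit r → r < 3 ^ suc n → sier (k * 3 ^ suc n + r) ≡ a → sier k ≡ a × sier r ≡ a
  go (ends0 q) = peel 0 {q} sier[q*3]≡sier[q]
  go (ends1 q) _ eq =
    ⊥-elim (b≢a (trans (sym (sier[1+q*3]≡b (k * 3 ^ n + q))) (subst (λ m → sier m ≡ a) (regroup k (3 ^ n) 1 q) eq)))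
  go (ends2 q) = peel 2 {q} sier[2+q*3]≡sier[q]

sier-a⇒next-b : ∀ k → sier k ≡ a → sier (suc k) ≡ b
sier-a⇒next-b k = go (lastTrit k) (<-wellFounded k)
  where
  go : ∀ {k} → LastTrit k → Acc _<_ k → sier k ≡ a → sier (suc k) ≡ b
  go (ends0 q) _ _ = sier[1+q*3]≡b q
  go (ends1 q) _ eq = ⊥-elim (b≢a (trans (sym (sier[1+q*3]≡b q)) eq))
  go (ends2 q) (acc rs) eq = trans (sier[q*3]≡sier[q] (suc q))
    (go (lastTrit q) (rs (s≤s (m≤n⇒m≤1+n (m≤m*n q 3)))) (trans (sym (sier[2+q*3]≡sier[q] q)) eq))

sier-a⇒next-block-b : ∀ n k {r} → r < 3 ^ n → sier k ≡ a → sier (suc k * 3 ^ n + r) ≡ b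
sier-a⇒next-block-b n k {r} r< ka with sier (suc k * 3 ^ n + r) ≟ₗ a
... | yes eq = ⊥-elim (b≢a (trans (sym (sier-a⇒next-b k ka)) (proj₁ (sier-a-split n (suc k) r< eq))))
... | no ne = ≢a⇒≡b ne

sier-a-apart : ∀ {k k′} → sier k ≡ a → sier k′ ≡ a → k < k′ → suc k < k′
sier-a-apart {k} ka k′a k<k′ with m≤n⇒m<n∨m≡n k<k′
... | inj₁ 1+k<k′ = 1+k<k′
... | inj₂ refl = ⊥-elim (b≢a (trans (sym (sier-a⇒next-b k ka)) k′a))

a-residues₉ : List ℕ
a-residues₉ = 0 ∷ 2 ∷ 6 ∷ 8 ∷ []

sier-a-below-9 : ∀ {e} → e < 9 → sier e ≡ a → e ∈ a-residues₉
sier-a-below-9 {0} _ _ = here refl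
sier-a-below-9 {1} _ ()
sier-a-below-9 {2} _ _ = there (here refl)
sier-a-below-9 {3} _ ()
sier-a-below-9 {4} _ ()
sier-a-below-9 {5} _ ()
sier-a-below-9 {6} _ _ = there (there (here refl))
sier-a-below-9 {7} _ ()
sier-a-below-9 {8} _ _ = there (there (there (here refl)))
sier-a-below-9 {suc (suc (suc (suc (suc (suc (suc (suc (suc _))))))))}
  (s≤s (s≤s (s≤s (s≤s (s≤s (s≤s (s≤s (s≤s (s≤s ()))))))))) _

sier-a-near-residue : ∀ t k {r} → r < 3 ^ (2 + t) → sier (k * 3 ^ (2 + t) + r) ≡ a →
                      ∃[ e ] e ∈ a-residues₉ × e * 3 ^ t ≤ r × r < e * 3 ^ t + 3 ^ t
sier-a-near-residue t k {r} r< eq =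
  r / u , sier-a-below-9 r/u<9 r/u-a , m/n*n≤m r u , subst (r <_) (+-comm u (r / u * u)) (m<[1+m/n]*n r u)
  where
  u = 3 ^ t
  instance
    u≢0 : NonZero u
    u≢0 = m^n≢0 3 t
  r-a : sier r ≡ a
  r-a = proj₂ (sier-a-split (2 + t) k r< eq)
  r/u-a : sier (r / u) ≡ a
  r/u-a = proj₁ (sier-a-split t (r / u) (m%n<n r u)
            (subst (λ m → sier m ≡ a) (m≡[m/n]*n+m%n r u) r-a))
  r/u<9 : r / u < 9
  r/u<9 = m<n*o⇒m/o<n (subst (r <_) (^-distribˡ-+-* 3 2 t) r<)

BBlock : (ℕ → Letter) → ℕ → ℕ → ℕ → Set
BBlock x i m j = ∀ t → t < m → x (i + j * m + t) ≡ b

TwoBBlocks : ℕ → (ℕ → Letter) → ℕ → ℕ → Set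
TwoBBlocks k x i m = ∃[ j ] ∃[ j′ ] j < k × j′ < k × j ≢ j′ × BBlock x i m j × BBlock x i m j′

bBlock-word : ∀ {x i m j} → BBlock x i m j → block x i m j ≡ map (λ _ → b) (upTo m)
bBlock-word {x} {i} {m} {j} bj = map-cong-local (applyUpTo⁺₁ {P = λ t → x (i + j * m + t) ≡ b} (λ t → t) m (bj _))

bRun⇒twoBBlocks : ∀ {k x i M} .{{_ : NonZero M}} S L → 3 * M ≤ L → i ≤ S → S + L ≤ i + k * M →
                  (∀ p → S ≤ p → p < S + L → x p ≡ b) → TwoBBlocks k x i M
bRun⇒twoBBlocks {k} {x} {i} {M} S L 3M≤L i≤S S+L≤ run =
  j , suc j , below (n≤1+n (suc j)) , below ≤-refl , <⇒≢ (n<1+n j) ,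
  inRun ≤-refl (n≤1+n (suc j)) , inRun (n≤1+n j) ≤-refl
  where
  d = S ∸ i
  j = suc (d / M)
  i+d≡S : i + d ≡ S
  i+d≡S = m+[n∸m]≡n i≤S
  top : suc (suc j) * M ≤ d + L
  top = begin
    M + (M + (M + d / M * M))  ≤⟨ +-monoʳ-≤ M (+-monoʳ-≤ M (+-monoʳ-≤ M (m/n*n≤m d M))) ⟩
    M + (M + (M + d))          ≡⟨ rearrange M d ⟩
    d + 3 * M                  ≤⟨ +-monoʳ-≤ d 3M≤L ⟩
    d + L                      ∎
    where
    open ≤-Reasoning
    rearrange : ∀ M d → M + (M + (M + d)) ≡ d + 3 * M
    rearrange = solve-∀
  d+L≤k*M : d + L ≤ k * M
  d+L≤k*M = +-cancelˡ-≤ i _ _ (subst (_≤ i + k * M) (trans (cong (_+ L) (sym i+d≡S)) (+-assoc i d L)) S+L≤)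
  below : ∀ {j′} → suc j′ ≤ suc (suc j) → j′ < k
  below j′<2+j = *-cancelʳ-≤ (suc _) k M (≤-trans (*-monoˡ-≤ M j′<2+j) (≤-trans top d+L≤k*M))
  inRun : ∀ {j′} → j ≤ j′ → suc j′ ≤ suc (suc j) → BBlock x i M j′
  inRun {j′} j≤j′ j′<2+j t t<M = run (i + j′ * M + t) lower upper
    where
    open ≤-Reasoning
    lower : S ≤ i + j′ * M + t
    lower = begin
      S              ≡⟨ i+d≡S ⟨
      i + d          ≤⟨ +-monoʳ-≤ i (<⇒≤ (m<[1+m/n]*n d M)) ⟩
      i + j * M      ≤⟨ +-monoʳ-≤ i (*-monoˡ-≤ M j≤j′) ⟩
      i + j′ * M     ≤⟨ m≤m+n _ t ⟩
      i + j′ * M + t ∎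
    upper : i + j′ * M + t < S + L
    upper = begin-strict
      i + j′ * M + t    ≡⟨ +-assoc i (j′ * M) t ⟩
      i + (j′ * M + t)  <⟨ +-monoʳ-< i (+-monoʳ-< (j′ * M) t<M) ⟩
      i + (j′ * M + M)  ≡⟨ cong (i +_) (+-comm (j′ * M) M) ⟩
      i + suc j′ * M    ≤⟨ +-monoʳ-≤ i (≤-trans (*-monoˡ-≤ M j′<2+j) top) ⟩
      i + (d + L)       ≡⟨ +-assoc i d L ⟨
      i + d + L         ≡⟨ cong (_+ L) i+d≡S ⟩
      S + L             ∎

fewABlocks⇒twoBBlocks : ∀ {k x i M} (F : List ℕ) → 2 + length F ≤ k →
                        (∀ j t → j < k → t < M → x (i + j * M + t) ≡ a → j ∈ F) → TwoBBlocks k x i M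
fewABlocks⇒twoBBlocks {k} {x} {i} {M} F 2+|F|≤k hit with ∃-∉-below F (≤-trans (n≤1+n _) 2+|F|≤k)
... | j , j<k , j∉F with ∃-∉-below (j ∷ F) 2+|F|≤k
...   | j′ , j′<k , j′∉j∷F =
  j , j′ , j<k , j′<k , (λ { refl → j′∉j∷F (here refl) }) ,
  allB j<k j∉F , allB j′<k (λ j′∈F → j′∉j∷F (there j′∈F))
  where
  allB : ∀ {j} → j < k → j ∉ F → BBlock x i M j
  allB {j} j<k j∉F t t<M = ≢a⇒≡b (λ isA → j∉F (hit j t j<k t<M isA))

blockIndex-near : ∀ {M D j t} .{{_ : NonZero M}} → t < M → D ≤ j * M + t → j * M + t ≤ D + M →
                  j ≡ D / M ⊎ j ≡ suc (D / M)
blockIndex-near {M} {D} {j} {t} t<M lower upper = decide (m≤n⇒m<n∨m≡n D/M≤j)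
  where
  open ≤-Reasoning
  D/M≤j : D / M ≤ j
  D/M≤j = s≤s⁻¹ (*-cancelʳ-< M (D / M) (suc j) (begin-strict
    D / M * M   ≤⟨ m/n*n≤m D M ⟩
    D           ≤⟨ lower ⟩
    j * M + t   <⟨ +-monoʳ-< (j * M) t<M ⟩
    j * M + M   ≡⟨ +-comm (j * M) M ⟩
    suc j * M   ∎))
  j≤1+D/M : j ≤ suc (D / M)
  j≤1+D/M = s≤s⁻¹ (*-cancelʳ-< M j (suc (suc (D / M))) (begin-strict
    j * M                  ≤⟨ m≤m+n (j * M) t ⟩
    j * M + t              ≤⟨ upper ⟩
    D + M                  <⟨ +-monoˡ-< M (m<[1+m/n]*n D M) ⟩
    suc (D / M) * M + M    ≡⟨ +-comm (suc (D / M) * M) M ⟩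
    suc (suc (D / M)) * M  ∎))
  decide : D / M < j ⊎ D / M ≡ j → j ≡ D / M ⊎ j ≡ suc (D / M)
  decide (inj₁ D/M<j) = inj₂ (≤-antisym j≤1+D/M D/M<j)
  decide (inj₂ D/M≡j) = inj₁ (sym D/M≡j)

shortCover⇒twoBBlocks : ∀ {k x i M} .{{_ : NonZero M}} (Ps : List ℕ) → 2 + 2 * length Ps ≤ k →
                        (∀ o → o < k * M → x (i + o) ≡ a → ∃[ P ] P ∈ Ps × P ≤ i + o × i + o ≤ P + M) →
                        TwoBBlocks k x i M
shortCover⇒twoBBlocks {k} {x} {i} {M} Ps bound cover =
  fewABlocks⇒twoBBlocks {x = x} {i = i} (nearBlocks Ps)
    (subst (λ n → 2 + n ≤ k) (sym (length-nearBlocks Ps)) bound) hit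
  where
  β : ℕ → ℕ
  β P = (P ∸ i) / M
  nearBlocks : List ℕ → List ℕ
  nearBlocks [] = []
  nearBlocks (P ∷ Ps) = β P ∷ suc (β P) ∷ nearBlocks Ps
  length-nearBlocks : ∀ Ps → length (nearBlocks Ps) ≡ 2 * length Ps
  length-nearBlocks [] = refl
  length-nearBlocks (P ∷ Ps) = trans (cong (2 +_) (length-nearBlocks Ps)) (sym (*-suc 2 (length Ps)))
  ∈-nearBlocks : ∀ {P Ps j} → P ∈ Ps → j ≡ β P ⊎ j ≡ suc (β P) → j ∈ nearBlocks Ps
  ∈-nearBlocks (here refl) (inj₁ j≡β) = here j≡β
  ∈-nearBlocks (here refl) (inj₂ j≡1+β) = there (here j≡1+β)
  ∈-nearBlocks (there P∈Ps) j-near = there (there (∈-nearBlocks P∈Ps j-near))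
  hit : ∀ j t → j < k → t < M → x (i + j * M + t) ≡ a → j ∈ nearBlocks Ps
  hit j t j<k t<M isA
    with cover (j * M + t) (j*M+t<k*M j<k t<M) (subst (λ p → x p ≡ a) (+-assoc i (j * M) t) isA)
  ... | P , P∈Ps , P≤ , ≤P+M = ∈-nearBlocks P∈Ps (blockIndex-near t<M (m≤n+o⇒m∸n≤o P i P≤) o≤P∸i+M)
    where
    o≤P∸i+M : j * M + t ≤ P ∸ i + M
    o≤P∸i+M = +-cancelˡ-≤ i _ _
      (≤-trans ≤P+M (≤-trans (+-monoˡ-≤ M (m≤n+m∸n P i)) (≤-reflexive (+-assoc i (P ∸ i) M))))

sier-as-apart⇒twoBBlocks : ∀ {k i M} n .{{_ : NonZero M}} .{{_ : NonZero (3 ^ n)}} → 3 * M ≤ 3 ^ n →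
                           ∀ {x y} → i ≤ x → y < i + k * M → x / 3 ^ n < y / 3 ^ n →
                           sier x ≡ a → sier y ≡ a → TwoBBlocks k sier i M
sier-as-apart⇒twoBBlocks {k} {i} {M} n 3M≤U {x} {y} i≤x y< kx<ky x-a y-a =
  bRun⇒twoBBlocks S U 3M≤U i≤S S+U≤ run
  where
  U = 3 ^ n
  sier-quotient-a : ∀ {p} → sier p ≡ a → sier (p / U) ≡ a
  sier-quotient-a {p} p-a =
    proj₁ (sier-a-split n (p / U) (m%n<n p U) (subst (λ q → sier q ≡ a) (m≡[m/n]*n+m%n p U) p-a))
  S = suc (x / U) * U
  i≤S : i ≤ S
  i≤S = ≤-trans i≤x (<⇒≤ (m<[1+m/n]*n x U))
  S+U≤ : S + U ≤ i + k * M
  S+U≤ = begin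
    S + U                  ≡⟨ +-comm S U ⟩
    suc (suc (x / U)) * U  ≤⟨ *-monoˡ-≤ U (sier-a-apart (sier-quotient-a x-a) (sier-quotient-a y-a) kx<ky) ⟩
    y / U * U              ≤⟨ m/n*n≤m y U ⟩
    y                      ≤⟨ <⇒≤ y< ⟩
    i + k * M              ∎
    where open ≤-Reasoning
  run : ∀ p → S ≤ p → p < S + U → sier p ≡ b
  run p S≤p p<S+U =
    subst (λ q → sier q ≡ b) (m+[n∸m]≡n S≤p) (sier-a⇒next-block-b n (x / U) p∸S<U (sier-quotient-a x-a))
    where
    p∸S<U : p ∸ S < U
    p∸S<U = +-cancelˡ-< S _ _ (subst (_< S + U) (sym (m+[n∸m]≡n S≤p)) p<S+U)

sier-as-in-one-block⇒twoBBlocks : ∀ {k i M} t k₀ .{{_ : NonZero M}} .{{_ : NonZero (3 ^ (2 + t))}} →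
                                  10 ≤ k → 3 ^ t ≤ suc M →
                                  (∀ o → o < k * M → sier (i + o) ≡ a → (i + o) / 3 ^ (2 + t) ≡ k₀) →
                                  TwoBBlocks k sier i M
sier-as-in-one-block⇒twoBBlocks {k} {i} {M} t k₀ 10≤k u≤1+M sameBlock =
  shortCover⇒twoBBlocks {x = sier} {i = i} (map subblock a-residues₉) 10≤k cover
  where
  u = 3 ^ t
  U = 3 ^ (2 + t)
  subblock : ℕ → ℕ
  subblock e = k₀ * U + e * u
  cover : ∀ o → o < k * M → sier (i + o) ≡ a →
          ∃[ P ] P ∈ map subblock a-residues₉ × P ≤ i + o × i + o ≤ P + M
  cover o o< isA = located (sier-a-near-residue t k₀ (m%n<n p U) (subst (λ q → sier q ≡ a) p≡k₀U+r isA))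
    where
    p = i + o
    r = p % U
    p≡k₀U+r : p ≡ k₀ * U + r
    p≡k₀U+r = trans (m≡[m/n]*n+m%n p U) (cong (λ q → q * U + r) (sameBlock o o< isA))
    located : ∃[ e ] e ∈ a-residues₉ × e * u ≤ r × r < e * u + u →
              ∃[ P ] P ∈ map subblock a-residues₉ × P ≤ p × p ≤ P + M
    located (e , e∈ , eu≤r , r<eu+u) = subblock e , ∈-map⁺ subblock e∈ , lower , upper
      where
      open ≤-Reasoning
      lower : subblock e ≤ p
      lower = subst (subblock e ≤_) (sym p≡k₀U+r) (+-monoʳ-≤ (k₀ * U) eu≤r)
      upper : p ≤ subblock e + M
      upper = s≤s⁻¹ (begin-strict
        p                     ≡⟨ p≡k₀U+r ⟩
        k₀ * U + r            <⟨ +-monoʳ-< (k₀ * U) r<eu+u ⟩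
        k₀ * U + (e * u + u)  ≡⟨ +-assoc (k₀ * U) (e * u) u ⟨
        subblock e + u        ≤⟨ +-monoʳ-≤ (subblock e) u≤1+M ⟩
        subblock e + suc M    ≡⟨ +-suc (subblock e) M ⟩
        suc (subblock e + M)  ∎)

sier-twoBBlocks : ∀ i M → TwoBBlocks 11 sier i M
sier-twoBBlocks i zero = 0 , 1 , z<s , s<s z<s , (λ ()) , (λ _ ()) , (λ _ ())
sier-twoBBlocks i M@(suc _) with power-bracket 3 (s≤s (s≤s z≤n)) M
... | t , 3^t≤1+M , 1+M<3^[1+t] = window
  where
  U = 3 ^ (2 + t)
  instance
    U≢0 : NonZero U
    U≢0 = m^n≢0 3 (2 + t)
  3M≤U : 3 * M ≤ U
  3M≤U = *-monoʳ-≤ 3 (<⇒≤ (<-trans (n<1+n M) 1+M<3^[1+t]))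
  isA? : ∀ o → Dec (sier (i + o) ≡ a)
  isA? o = sier (i + o) ≟ₗ a
  inWindow : ∀ {o} → o < 11 * M → i + o < i + 11 * M
  inWindow = +-monoʳ-< i
  window : TwoBBlocks 11 sier i M
  window with anyUpTo? isA? (11 * M)
  ... | no noA =
    shortCover⇒twoBBlocks {x = sier} {i = i} [] (s≤s (s≤s z≤n)) (λ o o< isA → ⊥-elim (noA (o , o< , isA)))
  ... | yes (o₀ , o₀< , a₀) with anyUpTo? (λ o → isA? o ×-dec ¬? ((i + o) / U ≟ (i + o₀) / U)) (11 * M)
  ...   | no none = sier-as-in-one-block⇒twoBBlocks {i = i} t ((i + o₀) / U) (n≤1+n 10) 3^t≤1+M sameBlock
    where
    sameBlock : ∀ o → o < 11 * M → sier (i + o) ≡ a → (i + o) / U ≡ (i + o₀) / U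
    sameBlock o o< isA = decidable-stable ((i + o) / U ≟ (i + o₀) / U) (λ k≢k₀ → none (o , o< , isA , k≢k₀))
  ...   | yes (o₁ , o₁< , a₁ , k₁≢k₀) with <-cmp ((i + o₀) / U) ((i + o₁) / U)
  ...     | tri< k₀<k₁ _ _ =
    sier-as-apart⇒twoBBlocks {i = i} (2 + t) 3M≤U (m≤m+n i o₀) (inWindow o₁<) k₀<k₁ a₀ a₁
  ...     | tri≈ _ k₀≡k₁ _ = ⊥-elim (k₁≢k₀ (sym k₀≡k₁))
  ...     | tri> _ _ k₁<k₀ =
    sier-as-apart⇒twoBBlocks {i = i} (2 + t) 3M≤U (m≤m+n i o₁) (inWindow o₀<) k₁<k₀ a₁ a₀

twoBBlocks⇒¬antipower : ∀ {k x} → (∀ i m → TwoBBlocks k x i m) → ¬ HasAntipowerFactor k x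
twoBBlocks⇒¬antipower {x = x} two (i , m , distinct) with two i m
... | j , j′ , j< , j′< , j≢j′ , bj , bj′ =
  distinct j j′ j< j′< j≢j′ (trans (bBlock-word {x} {i} {m} {j} bj) (sym (bBlock-word {x} {i} {m} {j′} bj′)))

¬antipower⇒¬abelianAntipower : ∀ {k x} → ¬ HasAntipowerFactor k x → ¬ HasAbelianAntipowerFactor k x
¬antipower⇒¬abelianAntipower ¬ap (i , m , distinct) =
  ¬ap (i , m , λ j j′ j< j′< j≢j′ same → distinct j j′ j< j′< j≢j′ (cong parikh same))

mainTheorem1 : ¬ HasAntipowerFactor 11 sier × ¬ HasAbelianAntipowerFactor 11 sier
mainTheorem1 = ¬antipower , ¬antipower⇒¬abelianAntipower {x = sier} ¬antipower
  where
  ¬antipower : ¬ HasAntipowerFactor 11 sier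
  ¬antipower = twoBBlocks⇒¬antipower {x = sier} sier-twoBBlocks
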